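{- Assume the following statement holds: for every positive integer $b$ and every subset $S\subseteq\{1,\ldots,b-1\}$ such that there is no prime number $p$ dividing $\prod_{a\in S}(b\cdot k + a)$ for every $k\in\mathbb{N}$, there exists $k\in\mathbb{N}$ such that for all $a\in\{1,\ldots,b-1\}$, $b\cdot k + a$ is prime if and only if $a\in S$. Then the language $\textsc{Primes} = \{u \in \{0,1\}^* \mid \mathrm{bin}(u) \text{ is prime}\}$ does not have subexponential alternating online state complexity, i.e. there is no function $f:\mathbb{N}\to\mathbb{N}$ with $f = o(C^n)$ for all $C>1$ such that $\textsc{Primes}\in\mathrm{Alt}(f)$.
   Context: For a word $w = w(0)w(1)\cdots w(n-1)\in\{0,1\}^*$, $\mathrm{bin}(w) = \sum_{i=0}^{n-1} w(i)2^i$ (least significant digit on the left). An alternating machine over a finite alphabet $A$ consists of a (possibly infinite) set of states $Q$, an initial state $q_0\in Q$, a transition function $\delta: Q\times A\to\mathcal{B}^+(Q)$ (positive boolean formulae over $Q$) and a set $F\subseteq Q$ of accepting states. For an input word $w$, the acceptance game $\mathcal{G}_{\mathcal{A},w}$ is played by Prover and Verifier: starting in $q_0$, the letters of $w$ are read from left to right; in state $q$ reading letter $a$, the next state is obtained from the formula $\delta(q,a)$, Prover resolving disjunctions and Verifier resolving conjunctions. Prover wins a play if it ends in a state of $F$. The word $w$ is accepted if Prover has a winning strategy; the language recognised is the set of accepted words. For $f:\mathbb{N}\to\mathbb{N}$, a language $L$ is in $\mathrm{Alt}(f)$ if there are an alternating machine recognising $L$ and a constant $C$ such that for all $n\in\mathbb{N}$,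 the number of states $q$ for which there exists a word $w$ of length at most $n$ with $q$ appearing in the game $\mathcal{G}_{\mathcal{A},w}$ is at most $C\cdot f(n)$. -}

module Defs where

open import Data.Nat using (ℕ; zero; suc; _+_; _*_; _^_; _≤_; _<_)
open import Data.Nat.Divisibility using (_∣_)
open import Data.Nat.Primality using (Prime)
open import Data.Bool using (Bool; true; false; if_then_else_)
open import Data.Fin using (Fin; toℕ)
open import Data.List using (List; []; _∷_; length; map; allFin)
open import Data.Nat.ListAction using (product)
open import Data.List.Membership.Propositional using (_∈_)
open import Data.Product using (Σ; _×_; _,_)
open import Data.Sum using (_⊎_)
open import Data.Unit using (⊤)
open import Data.Empty using (⊥)
open import Relation.Nullary using (¬_)
open import Relation.Binary.PropositionalEquality using (_≡_)
open import Function.Bundles using (_⇔_)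

-- Binary words, least significant digit first (on the left).

bin : List Bool → ℕ
bin []          = 0
bin (b ∷ w) = (if b then 1 else 0) + 2 * bin w

Primes : List Bool → Set
Primes u = Prime (bin u)

data PBF (Q : Set) : Set where
  atom : Q → PBF Q
  tt   : PBF Q
  ff   : PBF Q
  _∧_  : PBF Q → PBF Q → PBF Q
  _∨_  : PBF Q → PBF Q → PBF Q

-- Evaluation of a formula given, for each state, the proposition
-- "Prover wins from this state" (Prover resolves ∨, Verifier ∧).
Eval : {Q : Set} → (Q → Set) → PBF Q → Set
Eval v (atom q) = v q
Eval v tt       = ⊤
Eval v ff       = ⊥
Eval v (φ ∧ ψ)  = Eval v φ × Eval v ψ
Eval v (φ ∨ ψ)  = Eval v φ ⊎ Eval v ψ

data Occurs {Q : Set} (q : Q) : PBF Q → Set where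
  here  : Occurs q (atom q)
  ∧ˡ    : ∀ {φ ψ} → Occurs q φ → Occurs q (φ ∧ ψ)
  ∧ʳ    : ∀ {φ ψ} → Occurs q ψ → Occurs q (φ ∧ ψ)
  ∨ˡ    : ∀ {φ ψ} → Occurs q φ → Occurs q (φ ∨ ψ)
  ∨ʳ    : ∀ {φ ψ} → Occurs q ψ → Occurs q (φ ∨ ψ)

record AltMachine (A : Set) : Set₁ where
  field
    Q   : Set
    q₀  : Q
    δ   : Q → A → PBF Q
    F   : Q → Set

module _ {A : Set} (M : AltMachine A) where
  open AltMachine M

  -- Prover has a winning strategy in the (finite, hence determined)
  -- acceptance game from state q on the remaining input w.
  Wins : Q → List A → Set
  Wins q []      = F q
  Wins q (a ∷ w) = Eval (λ q' → Wins q' w) (δ q a)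

  Accepts : List A → Set
  Accepts w = Wins q₀ w

  data Reach : Q → List A → Q → Set where
    start : ∀ {q w} → Reach q w q
    step  : ∀ {q a w q'' q'} → Occurs q'' (δ q a) → Reach q'' w q' →
            Reach q (a ∷ w) q'

  AppearsIn : List A → Q → Set
  AppearsIn w q = Reach q₀ w q

  Recognises : (List A → Set) → Set
  Recognises L = ∀ w → Accepts w ⇔ L w

  AppearingBoundedBy : ℕ → ℕ → Set
  AppearingBoundedBy n N =
    Σ (List Q) λ qs → length qs ≤ N ×
      (∀ (w : List A) (q : Q) → length w ≤ n → AppearsIn w q → q ∈ qs)

InAlt : {A : Set} → (ℕ → ℕ) → (List A → Set) → Set₁
InAlt {A} f L = Σ (AltMachine A) λ M → Recognises M L ×
  Σ ℕ λ C → ∀ n → AppearingBoundedBy M n (C * f n)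

-- f = o(C^n) for every C > 1.  Real C > 1 are replaced by rationals
-- p / q > 1 (equivalent, since every real C > 1 lies above a rational
-- > 1), and ε > 0 by 1 / (suc m):
--   ∀ ε > 0, eventually f n ≤ ε (p/q)^n.
Subexponential : (ℕ → ℕ) → Set
Subexponential f =
  ∀ (p q : ℕ) → 1 ≤ q → q < p → ∀ (m : ℕ) →
    Σ ℕ λ N → ∀ n → N ≤ n → suc m * f n * q ^ n ≤ p ^ n

-- The number-theoretic hypothesis (a Dickson/Schinzel-type statement).
-- A subset S ⊆ {1,…,b-1} is a function S : Fin b → Bool with S 0 = false.

prodS : (b : ℕ) → (Fin b → Bool) → ℕ → ℕ
prodS b S k = product (map (λ i → if S i then b * k + toℕ i else 1) (allFin b))

Hypothesis : Set
Hypothesis =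
  ∀ (b : ℕ) → 1 ≤ b → (S : Fin b → Bool) →
    (∀ i → toℕ i ≡ 0 → S i ≡ false) →
    ¬ (Σ ℕ λ p → Prime p × (∀ k → p ∣ prodS b S k)) →
    Σ ℕ λ k → ∀ (i : Fin b) → 1 ≤ toℕ i →
      (Prime (b * k + toℕ i) ⇔ (S i ≡ true))

-- Chebyshev's bound C(2M, M) ≤ (2M)^π(2M), with the prime powers dividing C(2M, M) controlled by
-- Legendre's formula, yields T = 2^r primes U_j in (T, 4^r). For each set V of them the hypothesis,
-- applied with b = 4^r (admissible: a prime p > T cannot divide some b k + U_j for each of the T + 1
-- shifts k = 0, …, T), gives k_V with b k_V + U_j prime exactly when U_j ∈ V. Reading the 2r digits
-- of U_j first, every state reached is one of the at most C f(2r) states appearing on words of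
-- length 2r, and the set of those winning on the digits of k_V determines V. So 2^T ≤ 2^(C f(2r)),
-- i.e. 2^r ≤ C f(2r), which fails for f = o((5/4)^n) because 2 · 4² > 5².

module Submission where

open import Data.Bool using (Bool; true; false; if_then_else_)
open import Data.Bool.Properties using (⇔→≡) renaming (_≟_ to _≟ᵇ_)
open import Data.Fin as Fin using (Fin; toℕ)
open import Data.Fin.Properties
  using (any?; inject≤-injective; toℕ-injective; toℕ<n; toℕ-fromℕ<; injective⇒≤; pigeonhole)
open import Data.List using (List; []; _∷_; _++_; length; lookup; filter; upTo; tabulate; allFin)
open import Data.List.Properties using (length-++; length-filter; length-upTo; tabulate-cong; length-tabulate)
open import Data.List.Membership.Propositional using (_∈_)
open import Data.List.Membership.Propositional.Properties
  using (∈-filter⁺; ∈-filter⁻; ∈-++⁺ˡ; ∈-++⁺ʳ; ∈-upTo⁺; ∈-upTo⁻; ∈-lookup)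
open import Data.List.Relation.Unary.All as All using (All; []; _∷_)
import Data.List.Relation.Unary.All.Properties as All
open import Data.List.Relation.Unary.AllPairs using ([]; _∷_)
open import Data.List.Relation.Unary.Any as Any using (Any; here; there)
import Data.List.Relation.Unary.Any.Properties as Any
open import Data.List.Relation.Unary.Unique.Propositional using (Unique)
import Data.List.Relation.Unary.Unique.Propositional.Properties as Unique
open import Data.Nat
open import Data.Nat.Combinatorics
open import Data.Nat.Divisibility
open import Data.Nat.DivMod
open import Data.Nat.Induction using (<-wellFounded)
open import Data.Nat.ListAction using (product)
open import Data.Nat.Primality
open import Data.Nat.Primality.Factorisation using (factorise)
open import Data.Nat.Properties
open import Data.Nat.Tactic.RingSolver using (solve-∀)
open import Data.Product using (Σ; ∃-syntax; ∃₂; _×_; _,_; proj₁; proj₂)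
open import Data.Sum using (inj₁; inj₂; [_,_]′)
open import Function.Base using (_∘_)
open import Function.Bundles using (_⇔_; mk⇔; Equivalence)
open import Function.Construct.Composition using (_⇔-∘_)
open import Function.Definitions using (Injective)
open import Induction.WellFounded using (Acc; acc)
open import Relation.Binary.PropositionalEquality
open import Relation.Nullary using (¬_; Dec; does; yes; no; contradiction)
open import Relation.Nullary.Decidable
  using (_×-dec_; decidable-stable; ¬¬-excluded-middle; dec-true; dec-false; from-yes)

open import Defs

prime>1 : ∀ {p} → Prime p → 1 < p
prime>1 {p} p-prime = nonTrivial⇒n>1 p {{prime⇒nonTrivial p-prime}}

prime∤1 : ∀ {p} → Prime p → ¬ p ∣ 1
prime∤1 p-prime p∣1 = <⇒≢ (prime>1 p-prime) (sym (∣1⇒≡1 p∣1))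

prime∣product⇒∣some : ∀ {p} → Prime p → ∀ xs → p ∣ product xs → Any (p ∣_) xs
prime∣product⇒∣some p-prime []       p∣1 = contradiction p∣1 (prime∤1 p-prime)
prime∣product⇒∣some p-prime (x ∷ xs) p∣x*xs with euclidsLemma x (product xs) p-prime p∣x*xs
... | inj₁ p∣x  = here p∣x
... | inj₂ p∣xs = there (prime∣product⇒∣some p-prime xs p∣xs)

prime∣m^n⇒∣m : ∀ {p m} n → Prime p → p ∣ m ^ n → p ∣ m
prime∣m^n⇒∣m zero    p-prime p∣1 = contradiction p∣1 (prime∤1 p-prime)
prime∣m^n⇒∣m {m = m} (suc n) p-prime p∣m^sn with euclidsLemma m (m ^ n) p-prime p∣m^sn
... | inj₁ p∣m   = p∣m
... | inj₂ p∣m^n = prime∣m^n⇒∣m n p-prime p∣m^n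

prime∣n!⇒≤n : ∀ {p} n → Prime p → p ∣ n ! → p ≤ n
prime∣n!⇒≤n zero    p-prime p∣1 = contradiction p∣1 (prime∤1 p-prime)
prime∣n!⇒≤n (suc n) p-prime p∣n! with euclidsLemma (suc n) (n !) p-prime p∣n!
... | inj₁ p∣sn = ∣⇒≤ p∣sn
... | inj₂ p∣n! = m≤n⇒m≤1+n (prime∣n!⇒≤n n p-prime p∣n!)

/-≡-between : ∀ {m n q} .{{_ : NonZero n}} → q * n ≤ m → m < suc q * n → m / n ≡ q
/-≡-between {m} {n} {q} q*n≤m m<[1+q]*n = ≤-antisym
  (≤-pred (m<n*o⇒m/o<n m<[1+q]*n))
  (subst (_≤ m / n) (m*n/n≡m q n) (/-monoˡ-≤ n q*n≤m))

module _ {p : ℕ} (p-prime : Prime p) where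

  private instance
    p≢0 : NonZero p
    p≢0 = prime⇒nonZero p-prime

  p-part : ∀ x .{{_ : NonZero x}} → ∃₂ λ e R → x ≡ p ^ e * R × ¬ p ∣ R
  p-part x = go x (<-wellFounded x)
    where
    go : ∀ x .{{_ : NonZero x}} → Acc _<_ x → ∃₂ λ e R → x ≡ p ^ e * R × ¬ p ∣ R
    go x (acc rec) with p ∣? x
    ... | no p∤x = 0 , x , sym (+-identityʳ x) , p∤x
    ... | yes (divides-refl q) with go q {{q≢0}} (rec (m<m*n q p {{q≢0}} (prime>1 p-prime)))
      where
      q≢0 : NonZero q
      q≢0 = m*n≢0⇒m≢0 q
    ... | e , R , q≡p^e*R , p∤R = suc e , R , trans (cong (_* p) q≡p^e*R) (lemma (p ^ e) R p) , p∤R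
      where
      lemma : ∀ a b c → a * b * c ≡ c * a * b
      lemma = solve-∀

  p^k∣p^j*R⇒k≤j : ∀ {k j R} → p ^ k ∣ p ^ j * R → ¬ p ∣ R → k ≤ j
  p^k∣p^j*R⇒k≤j {k} {j} {R} p^k∣p^j*R p∤R with k ≤? j
  ... | yes k≤j = k≤j
  ... | no k≰j = contradiction (∣-trans (m∣m*n (p ^ t)) p^[1+t]∣R) p∤R
    where
    t : ℕ
    t = k ∸ suc j
    k≡ : k ≡ j + suc t
    k≡ = trans (sym (m+[n∸m]≡n (≰⇒> k≰j))) (sym (+-suc j t))
    instance
      p^j≢0 : NonZero (p ^ j)
      p^j≢0 = m^n≢0 p j
    p^[1+t]∣R : p ^ suc t ∣ R
    p^[1+t]∣R = *-cancelˡ-∣ (p ^ j)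
      (subst (_∣ p ^ j * R) (trans (cong (p ^_) k≡) (^-distribˡ-+-* p j (suc t))) p^k∣p^j*R)

m/n/o≡m/o/n : ∀ m n o .{{_ : NonZero n}} .{{_ : NonZero o}} → m / n / o ≡ m / o / n
m/n/o≡m/o/n m n o = begin
  m / n / o   ≡⟨ m/n/o≡m/[n*o] m n o ⟩
  m / (n * o) ≡⟨ /-congʳ (*-comm n o) ⟩
  m / (o * n) ≡⟨ m/n/o≡m/[n*o] m o n ⟨
  m / o / n   ∎
  where
  open ≡-Reasoning
  instance
    n*o≢0 : NonZero (n * o)
    n*o≢0 = m*n≢0 n o
    o*n≢0 : NonZero (o * n)
    o*n≢0 = m*n≢0 o n

n!≡nCk*[k!*[n∸k]!] : ∀ {n k} → k ≤ n → n ! ≡ (n C k) * (k ! * (n ∸ k) !)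
n!≡nCk*[k!*[n∸k]!] {n} {k} k≤n = sym (begin
  (n C k) * X   ≡⟨ cong (_* X) (nCk≡n!/k![n-k]! k≤n) ⟩
  n ! / X * X   ≡⟨ m/n*n≡m (k![n∸k]!∣n! k≤n) ⟩
  n !           ∎)
  where
  open ≡-Reasoning
  X : ℕ
  X = k ! * (n ∸ k) !
  instance
    X≢0 : NonZero X
    X≢0 = k !* (n ∸ k) !≢0

[2n]!≡central-binomial*[n!*n!] : ∀ n → (2 * n) ! ≡ ((2 * n) C n) * (n ! * n !)
[2n]!≡central-binomial*[n!*n!] n = subst (λ k → (2 * n) ! ≡ ((2 * n) C n) * (n ! * k !))
  (trans (m+n∸m≡n n (n + 0)) (+-identityʳ n)) (n!≡nCk*[k!*[n∸k]!] (m≤m+n n (n + 0)))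

-- Legendre's formula

module Legendre {p : ℕ} (p-prime : Prime p) where

  private instance
    p≢0 : NonZero p
    p≢0 = prime⇒nonZero p-prime

  private
    0/p≡0 : 0 / p ≡ 0
    0/p≡0 = 0/n≡0 p

  -- ⌊n/p⌋ + ⌊n/p²⌋ + ⋯ , the exponent of p in n! ; the first argument is fuel, n of it suffices.
  legendre′ : ℕ → ℕ → ℕ
  legendre′ zero    n = 0
  legendre′ (suc f) n = n / p + legendre′ f (n / p)

  legendre : ℕ → ℕ
  legendre n = legendre′ n n

  /p≤pred : ∀ {n f} → n ≤ suc f → n / p ≤ f
  /p≤pred {zero}  _     = subst (_≤ _) (sym 0/p≡0) z≤n
  /p≤pred {suc n} n≤1+f = ≤-pred (≤-trans (m/n<m (suc n) p (prime>1 p-prime)) n≤1+f)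

  legendre′-0 : ∀ f → legendre′ f 0 ≡ 0
  legendre′-0 zero    = refl
  legendre′-0 (suc f) rewrite 0/p≡0 = legendre′-0 f

  legendre′-fuel : ∀ {f g} n → n ≤ f → n ≤ g → legendre′ f n ≡ legendre′ g n
  legendre′-fuel {zero}  {zero}  n  _   _   = refl
  legendre′-fuel {zero}  {suc g} .0 z≤n _   = sym (legendre′-0 (suc g))
  legendre′-fuel {suc f} {zero}  .0 _   z≤n = legendre′-0 (suc f)
  legendre′-fuel {suc f} {suc g} n  n≤f n≤g =
    cong (n / p +_) (legendre′-fuel (n / p) (/p≤pred n≤f) (/p≤pred n≤g))

  legendre-rec : ∀ n → legendre n ≡ n / p + legendre (n / p)
  legendre-rec zero rewrite 0/p≡0 = refl
  legendre-rec (suc n) =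
    cong (suc n / p +_) (legendre′-fuel (suc n / p) (/p≤pred ≤-refl) ≤-refl)

  ∤⇒[1+n]/p≡n/p : ∀ {n} → ¬ p ∣ suc n → suc n / p ≡ n / p
  ∤⇒[1+n]/p≡n/p {n} p∤1+n = /-≡-between
    (≤-trans (m/n*n≤m n p) (n≤1+n n))
    (subst (_< p + q * p) (cong suc (sym n≡r+q*p)) (+-monoˡ-< (q * p) 1+r<p))
    where
    q r : ℕ
    q = n / p
    r = n % p
    n≡r+q*p : n ≡ r + q * p
    n≡r+q*p = m≡m%n+[m/n]*n n p
    1+r≢p : suc r ≢ p
    1+r≢p 1+r≡p = p∤1+n (divides (suc q) (trans (cong suc n≡r+q*p) (cong (_+ q * p) 1+r≡p)))
    1+r<p : suc r < p
    1+r<p = ≤∧≢⇒< (m%n<n n p) 1+r≢p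

  [1+n]≡[1+m]*p⇒n/p≡m : ∀ {n m} → suc n ≡ suc m * p → n / p ≡ m
  [1+n]≡[1+m]*p⇒n/p≡m {n} {m} 1+n≡ = /-≡-between
    (≤-pred (subst (suc (m * p) ≤_) (sym 1+n≡) (+-monoˡ-≤ (m * p) (<⇒≤ (prime>1 p-prime)))))
    (subst (n <_) 1+n≡ ≤-refl)

  legendre-suc : ∀ e {n R} → suc n ≡ p ^ e * R → ¬ p ∣ R → legendre (suc n) ≡ legendre n + e
  legendre-suc zero {n} {R} 1+n≡R p∤R = begin
    legendre (suc n)                 ≡⟨ legendre-rec (suc n) ⟩
    suc n / p + legendre (suc n / p) ≡⟨ cong (λ c → c + legendre c) (∤⇒[1+n]/p≡n/p p∤1+n) ⟩
    n / p + legendre (n / p)         ≡⟨ legendre-rec n ⟨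
    legendre n                       ≡⟨ +-identityʳ (legendre n) ⟨
    legendre n + 0                   ∎
    where
    open ≡-Reasoning
    p∤1+n : ¬ p ∣ suc n
    p∤1+n = subst (λ x → ¬ p ∣ x) (sym (trans 1+n≡R (+-identityʳ R))) p∤R
  legendre-suc (suc e) {n} {R} 1+n≡ p∤R with p ^ e * R in p^e*R≡
  ... | zero  = contradiction (trans 1+n≡ (trans (*-assoc p (p ^ e) R) (cong (p *_) p^e*R≡)))
                  (λ 1+n≡p*0 → 0≢1+n (trans (sym (*-zeroʳ p)) (sym 1+n≡p*0)))
  ... | suc m = begin
    legendre (suc n)                 ≡⟨ legendre-rec (suc n) ⟩
    suc n / p + legendre (suc n / p)   ≡⟨ cong (λ c → c + legendre c) [1+n]/p≡1+m ⟩
    suc m + legendre (suc m)           ≡⟨ cong (suc m +_) (legendre-suc e (sym p^e*R≡) p∤R) ⟩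
    suc m + (legendre m + e)           ≡⟨ lemma m (legendre m) e ⟩
    (m + legendre m) + suc e           ≡⟨ cong (λ c → (c + legendre c) + suc e) n/p≡m ⟨
    (n / p + legendre (n / p)) + suc e ≡⟨ cong (_+ suc e) (legendre-rec n) ⟨
    legendre n + suc e                 ∎
    where
    open ≡-Reasoning
    lemma : ∀ a b c → suc a + (b + c) ≡ (a + b) + suc c
    lemma = solve-∀
    1+n≡[1+m]*p : suc n ≡ suc m * p
    1+n≡[1+m]*p = trans 1+n≡ (trans (*-assoc p (p ^ e) R) (trans (cong (p *_) p^e*R≡) (*-comm p (suc m))))
    [1+n]/p≡1+m : suc n / p ≡ suc m
    [1+n]/p≡1+m = trans (/-congˡ 1+n≡[1+m]*p) (m*n/n≡m (suc m) p)
    n/p≡m : n / p ≡ m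
    n/p≡m = [1+n]≡[1+m]*p⇒n/p≡m 1+n≡[1+m]*p

  factorial-split : ∀ n → ∃[ R ] n ! ≡ p ^ legendre n * R × ¬ p ∣ R
  factorial-split zero = 1 , refl , prime∤1 p-prime
  factorial-split (suc n) with factorial-split n | p-part p-prime (suc n)
  ... | R , n!≡ , p∤R | e , R′ , 1+n≡ , p∤R′ =
    R′ * R , [1+n]!≡ , [ p∤R′ , p∤R ]′ ∘ euclidsLemma R′ R p-prime
    where
    open ≡-Reasoning
    lemma : ∀ a b c d → (a * b) * (c * d) ≡ (c * a) * (b * d)
    lemma = solve-∀
    [1+n]!≡ : suc n ! ≡ p ^ legendre (suc n) * (R′ * R)
    [1+n]!≡ = begin
      suc n * n !                           ≡⟨ cong₂ _*_ 1+n≡ n!≡ ⟩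
      (p ^ e * R′) * (p ^ legendre n * R)   ≡⟨ lemma (p ^ e) R′ (p ^ legendre n) R ⟩
      (p ^ legendre n * p ^ e) * (R′ * R)   ≡⟨ cong (_* (R′ * R)) (^-distribˡ-+-* p (legendre n) e) ⟨
      p ^ (legendre n + e) * (R′ * R)       ≡⟨ cong (λ x → p ^ x * (R′ * R)) (legendre-suc e 1+n≡ p∤R′) ⟨
      p ^ legendre (suc n) * (R′ * R)       ∎

  -- Each term ⌊a/pⁱ⌋ − 2⌊a/(2pⁱ)⌋ is at most 1, and it vanishes once pⁱ > a.
  legendre-halving : ∀ d a → a < p ^ suc d → legendre a ≤ 2 * legendre (a / 2) + d
  legendre-halving zero a a<p = begin
    legendre a               ≡⟨ legendre-rec a ⟩
    a / p + legendre (a / p) ≡⟨ cong (λ c → c + legendre c) (n<1⇒n≡0 (m<n*o⇒m/o<n a<p^1)) ⟩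
    0                        ≤⟨ z≤n ⟩
    2 * legendre (a / 2) + 0 ∎
    where
    open ≤-Reasoning
    a<p^1 : a < 1 * p
    a<p^1 = subst (a <_) (*-comm p 1) a<p
  legendre-halving (suc d) a a<p^[2+d] = begin
    legendre a                                         ≡⟨ legendre-rec a ⟩
    c + legendre c                                     ≤⟨ +-monoʳ-≤ c (legendre-halving d c c<p^[1+d]) ⟩
    c + (2 * legendre (c / 2) + d)                     ≡⟨ cong (_+ (2 * legendre (c / 2) + d)) (m≡m%n+[m/n]*n c 2) ⟩
    (c % 2 + c / 2 * 2) + (2 * legendre (c / 2) + d)   ≤⟨ +-monoˡ-≤ _ (+-monoˡ-≤ _ (≤-pred (m%n<n c 2))) ⟩
    (1 + c / 2 * 2) + (2 * legendre (c / 2) + d)       ≡⟨ lemma (c / 2) (legendre (c / 2)) d ⟩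
    2 * (c / 2 + legendre (c / 2)) + suc d             ≡⟨ cong (λ h → 2 * (h + legendre h) + suc d) a/2/p≡c/2 ⟨
    2 * (a / 2 / p + legendre (a / 2 / p)) + suc d     ≡⟨ cong (λ x → 2 * x + suc d) (legendre-rec (a / 2)) ⟨
    2 * legendre (a / 2) + suc d                       ∎
    where
    open ≤-Reasoning
    c : ℕ
    c = a / p
    a/2/p≡c/2 : a / 2 / p ≡ c / 2
    a/2/p≡c/2 = m/n/o≡m/o/n a 2 p
    c<p^[1+d] : c < p ^ suc d
    c<p^[1+d] = m<n*o⇒m/o<n (subst (a <_) (*-comm p (p ^ suc d)) a<p^[2+d])
    lemma : ∀ h l d → (1 + h * 2) + (2 * l + d) ≡ 2 * (h + l) + suc d
    lemma = solve-∀

  e+2*legendre≤ : ∀ {M e} → p ^ e ∣ (2 * M) C M → e + 2 * legendre M ≤ legendre (2 * M)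
  e+2*legendre≤ {M} {e} p^e∣C with factorial-split (2 * M) | factorial-split M
  ... | R₂ , [2M]!≡p^…*R₂ , p∤R₂ | R₁ , M!≡p^L*R₁ , _ =
    p^k∣p^j*R⇒k≤j p-prime
      (subst₂ _∣_ p^e*[p^L*p^L]≡ C*[M!*M!]≡ (*-pres-∣ p^e∣C (*-pres-∣ p^L∣M! p^L∣M!))) p∤R₂
    where
    L : ℕ
    L = legendre M
    p^L∣M! : p ^ L ∣ M !
    p^L∣M! = subst (p ^ L ∣_) (sym M!≡p^L*R₁) (m∣m*n R₁)
    p^e*[p^L*p^L]≡ : p ^ e * (p ^ L * p ^ L) ≡ p ^ (e + 2 * L)
    p^e*[p^L*p^L]≡ = sym (trans (^-distribˡ-+-* p e (2 * L))
      (cong (p ^ e *_) (trans (^-distribˡ-+-* p L (L + 0)) (cong (λ x → p ^ L * p ^ x) (+-identityʳ L)))))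
    C*[M!*M!]≡ : ((2 * M) C M) * (M ! * M !) ≡ p ^ legendre (2 * M) * R₂
    C*[M!*M!]≡ = trans (sym ([2n]!≡central-binomial*[n!*n!] M)) [2M]!≡p^…*R₂

  p^e∣central-binomial⇒≤ : ∀ {M e} .{{_ : NonZero M}} → p ^ e ∣ (2 * M) C M → p ^ e ≤ 2 * M
  p^e∣central-binomial⇒≤ {M} {zero}  _     = ≤-trans (>-nonZero⁻¹ M) (m≤m+n M (M + 0))
  p^e∣central-binomial⇒≤ {M} {suc d} p^e∣C = ≮⇒≥ λ 2M<p^[1+d] →
    1+n≰n (+-cancelˡ-≤ (2 * L) (suc d) d (begin
      2 * L + suc d                ≡⟨ +-comm (2 * L) (suc d) ⟩
      suc d + 2 * L                ≤⟨ e+2*legendre≤ {M} {suc d} p^e∣C ⟩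
      legendre (2 * M)             ≤⟨ legendre-halving d (2 * M) 2M<p^[1+d] ⟩
      2 * legendre (2 * M / 2) + d ≡⟨ cong (λ x → 2 * legendre x + d) 2M/2≡M ⟩
      2 * L + d                    ∎))
    where
    open ≤-Reasoning
    L : ℕ
    L = legendre M
    2M/2≡M : 2 * M / 2 ≡ M
    2M/2≡M = trans (/-congˡ (*-comm 2 M)) (m*n/n≡m M 2)

open Legendre using (p^e∣central-binomial⇒≤)

-- Chebyshev's bound

nCk≤[1+n]Ck : ∀ n k → n C k ≤ suc n C k
nCk≤[1+n]Ck n zero    = ≤-refl
nCk≤[1+n]Ck n (suc k) = subst (n C suc k ≤_) (nCk+nC[k+1]≡[n+1]C[k+1] n k) (m≤n+m _ _)

nCk≤[1+n]C[1+k] : ∀ n k → n C k ≤ suc n C suc k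
nCk≤[1+n]C[1+k] n k = subst (n C k ≤_) (nCk+nC[k+1]≡[n+1]C[k+1] n k) (m≤m+n _ _)

2^n≤central-binomial : ∀ n → 2 ^ n ≤ (2 * n) C n
2^n≤central-binomial zero    = ≤-refl
2^n≤central-binomial (suc n) = begin
  2 ^ suc n                              ≤⟨ *-monoʳ-≤ 2 (2^n≤central-binomial n) ⟩
  2 * (N C n)                            ≡⟨ cong (N C n +_) (+-identityʳ (N C n)) ⟩
  N C n + N C n                          ≤⟨ +-mono-≤ (nCk≤[1+n]Ck N n) (nCk≤[1+n]C[1+k] N n) ⟩
  suc N C n + suc N C suc n              ≡⟨ nCk+nC[k+1]≡[n+1]C[k+1] (suc N) n ⟩
  suc (suc N) C suc n                    ≡⟨ cong (_C suc n) (*-suc 2 n) ⟨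
  (2 * suc n) C suc n                    ∎
  where
  open ≤-Reasoning
  N : ℕ
  N = 2 * n

no-prime-divisor⇒≡1 : ∀ {n} .{{_ : NonZero n}} → (∀ {q} → Prime q → ¬ q ∣ n) → n ≡ 1
no-prime-divisor⇒≡1 {n} no-divisor with factorise n
... | record { factors = [] ; isFactorisation = n≡1 } = n≡1
... | record { factors = q ∷ qs ; isFactorisation = n≡q*qs ; factorsPrime = q-prime ∷ _ } =
  contradiction (subst (q ∣_) (sym n≡q*qs) (m∣m*n (product qs))) (no-divisor q-prime)

prime-powers≤⇒≤^length : ∀ {B} ps {n} .{{_ : NonZero n}} → All Prime ps →
  (∀ {q} → Prime q → q ∣ n → q ∈ ps) → (∀ {q} e → Prime q → q ^ e ∣ n → q ^ e ≤ B) →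
  n ≤ B ^ length ps
prime-powers≤⇒≤^length [] _ in-ps _ =
  ≤-reflexive (no-prime-divisor⇒≡1 (λ q-prime q∣n → Any.¬Any[] (in-ps q-prime q∣n)))
prime-powers≤⇒≤^length {B} (p ∷ ps) {n} {{n≢0}} (p-prime ∷ ps-prime) in-ps ≤B
  with p-part p-prime n
... | e , m , n≡p^e*m , p∤m = begin
  n           ≡⟨ n≡p^e*m ⟩
  p ^ e * m   ≤⟨ *-mono-≤ (≤B e p-prime (subst (p ^ e ∣_) (sym n≡p^e*m) (m∣m*n m))) m≤B^|ps| ⟩
  B * B ^ length ps ∎
  where
  open ≤-Reasoning
  m∣n : m ∣ n
  m∣n = subst (m ∣_) (sym n≡p^e*m) (n∣m*n (p ^ e))
  instance
    m≢0 : NonZero m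
    m≢0 = m*n≢0⇒n≢0 (p ^ e) {{subst NonZero n≡p^e*m n≢0}}
  in-ps′ : ∀ {q} → Prime q → q ∣ m → q ∈ ps
  in-ps′ q-prime q∣m with in-ps q-prime (∣-trans q∣m m∣n)
  ... | here refl = contradiction q∣m p∤m
  ... | there q∈ps = q∈ps
  m≤B^|ps| : m ≤ B ^ length ps
  m≤B^|ps| = prime-powers≤⇒≤^length ps ps-prime in-ps′
    (λ e′ q-prime q^e′∣m → ≤B e′ q-prime (∣-trans q^e′∣m m∣n))

central-binomial≤[2n]^|ps| : ∀ n .{{_ : NonZero n}} ps → All Prime ps →
  (∀ {q} → Prime q → q ≤ 2 * n → q ∈ ps) → (2 * n) C n ≤ (2 * n) ^ length ps
central-binomial≤[2n]^|ps| n ps ps-prime has-primes =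
  prime-powers≤⇒≤^length ps {{C≢0}} ps-prime in-ps
    (λ e q-prime → p^e∣central-binomial⇒≤ q-prime {e = e})
  where
  C≢0 : NonZero ((2 * n) C n)
  C≢0 = >-nonZero (≤-trans (m^n>0 2 n) (2^n≤central-binomial n))
  C∣[2n]! : (2 * n) C n ∣ (2 * n) !
  C∣[2n]! = subst ((2 * n) C n ∣_) (sym ([2n]!≡central-binomial*[n!*n!] n)) (m∣m*n _)
  in-ps : ∀ {q} → Prime q → q ∣ (2 * n) C n → q ∈ ps
  in-ps q-prime q∣C = has-primes q-prime (prime∣n!⇒≤n (2 * n) q-prime (∣-trans q∣C C∣[2n]!))

m^n≤m^o⇒n≤o : ∀ {m n o} → 1 < m → m ^ n ≤ m ^ o → n ≤ o
m^n≤m^o⇒n≤o {m} 1<m m^n≤m^o = ≮⇒≥ (λ o<n → <⇒≱ (^-monoʳ-< m 1<m o<n) m^n≤m^o)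

Unique⇒lookup-injective : ∀ {A : Set} {xs : List A} → Unique xs → Injective _≡_ _≡_ (lookup xs)
Unique⇒lookup-injective (_    ∷ _)   {Fin.zero}  {Fin.zero}  _  = refl
Unique⇒lookup-injective (x∉xs ∷ _)   {Fin.zero}  {Fin.suc j} eq = contradiction eq (All.lookup x∉xs (∈-lookup j))
Unique⇒lookup-injective (x∉xs ∷ _)   {Fin.suc i} {Fin.zero}  eq = contradiction (sym eq) (All.lookup x∉xs (∈-lookup i))
Unique⇒lookup-injective (_    ∷ xs!) {Fin.suc i} {Fin.suc j} eq = cong Fin.suc (Unique⇒lookup-injective xs! eq)

-- Chebyshev's argument: 2^M ≤ C(2M, M) ≤ (2M)^π(2M) with M = T²/2 forces at least T primes in (T, T²).
module ManyPrimes (s : ℕ) (8r<2^r : 8 * suc s < 2 ^ suc s) where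

  r T M B : ℕ
  r = suc s
  T = 2 ^ r
  M = 2 ^ (s + r)
  B = 2 ^ (r + r)

  large? : ∀ x → Dec (T < x × Prime x)
  large? x = T <? x ×-dec prime? x

  small large : List ℕ
  small = filter prime? (upTo (suc T))
  large = filter large? (upTo B)

  large-spec : ∀ {x} → x ∈ large → (T < x × Prime x) × x < B
  large-spec {x} x∈large with ∈-filter⁻ large? {xs = upTo B} x∈large
  ... | x∈upTo , T<x×x-prime = T<x×x-prime , ∈-upTo⁻ x∈upTo

  ¬prime-B : ¬ Prime B
  ¬prime-B B-prime = <⇒≱ (^-monoʳ-< 2 ≤-refl {1} {r + r} (s≤s (≤-trans (s≤s z≤n) (m≤n+m r s))))
    (∣⇒≤ (prime∣m^n⇒∣m (r + r) B-prime ∣-refl))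

  has-primes : ∀ {q} → Prime q → q ≤ 2 * M → q ∈ small ++ large
  has-primes {q} q-prime q≤B with q ≤? T
  ... | yes q≤T = ∈-++⁺ˡ (∈-filter⁺ prime? (∈-upTo⁺ (s≤s q≤T)) q-prime)
  ... | no  q≰T = ∈-++⁺ʳ small (∈-filter⁺ large? (∈-upTo⁺ q<B) (≰⇒> q≰T , q-prime))
    where
    q<B : q < B
    q<B = ≤∧≢⇒< q≤B (λ q≡B → ¬prime-B (subst Prime q≡B q-prime))

  all-prime : All Prime (small ++ large)
  all-prime = All.++⁺ (All.all-filter prime? (upTo (suc T)))
                      (All.map proj₂ (All.all-filter large? (upTo B)))

  T≤|large| : T ≤ length large
  T≤|large| with T ≤? length large
  ... | yes T≤ = T≤
  ... | no  T≰ = contradiction (begin-strict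
    2 * M                              ≤⟨ *-monoʳ-≤ 2 M≤[r+r]*[T+T] ⟩
    2 * ((r + r) * (T + T))            ≡⟨ lemma r T ⟩
    8 * r * T                          <⟨ *-monoˡ-< T {{m^n≢0 2 r}} 8r<2^r ⟩
    T * T                              ≡⟨ ^-distribˡ-+-* 2 r r ⟨
    B                                  ≡⟨⟩
    2 * M                              ∎) (<-irrefl refl)
    where
    open ≤-Reasoning
    lemma : ∀ r T → 2 * ((r + r) * (T + T)) ≡ 8 * r * T
    lemma = solve-∀
    n : ℕ
    n = length (small ++ large)
    2^M≤2^[[r+r]*n] : 2 ^ M ≤ 2 ^ ((r + r) * n)
    2^M≤2^[[r+r]*n] = begin
      2 ^ M          ≤⟨ 2^n≤central-binomial M ⟩
      (2 * M) C M    ≤⟨ central-binomial≤[2n]^|ps| M {{m^n≢0 2 (s + r)}} _ all-prime has-primes ⟩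
      B ^ n          ≡⟨ ^-*-assoc 2 (r + r) n ⟩
      2 ^ ((r + r) * n) ∎
    n≤T+T : n ≤ T + T
    n≤T+T = begin
      n                          ≡⟨ length-++ small ⟩
      length small + length large ≤⟨ +-monoˡ-≤ (length large) (length-filter prime? (upTo (suc T))) ⟩
      length (upTo (suc T)) + length large ≡⟨ cong (_+ length large) (length-upTo (suc T)) ⟩
      suc T + length large       ≡⟨ +-suc T (length large) ⟨
      T + suc (length large)     ≤⟨ +-monoʳ-≤ T (≰⇒> T≰) ⟩
      T + T                      ∎
    M≤[r+r]*[T+T] : M ≤ (r + r) * (T + T)
    M≤[r+r]*[T+T] = ≤-trans (m^n≤m^o⇒n≤o ≤-refl 2^M≤2^[[r+r]*n]) (*-monoʳ-≤ (r + r) n≤T+T)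

  U : Fin T → ℕ
  U j = lookup large (Fin.inject≤ j T≤|large|)

  U-injective : Injective _≡_ _≡_ U
  U-injective Ui≡Uj = inject≤-injective T≤|large| T≤|large| _ _
    (Unique⇒lookup-injective (Unique.filter⁺ _ (Unique.upTo⁺ B)) Ui≡Uj)

  U-spec : ∀ j → (T < U j × Prime (U j)) × U j < B
  U-spec j = large-spec (∈-lookup (Fin.inject≤ j T≤|large|))

  U-prime : ∀ j → Prime (U j)
  U-prime = proj₂ ∘ proj₁ ∘ U-spec

  T<U : ∀ j → T < U j
  T<U = proj₁ ∘ proj₁ ∘ U-spec

  U<B : ∀ j → U j < B
  U<B = proj₂ ∘ U-spec

bit : Bool → ℕ
bit b = if b then 1 else 0

bit-injective : ∀ {a b} → bit a ≡ bit b → a ≡ b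
bit-injective {false} {false} _ = refl
bit-injective {true}  {true}  _ = refl

[bit+2*n]%2≡bit : ∀ b n → (bit b + 2 * n) % 2 ≡ bit b
[bit+2*n]%2≡bit b n =
  trans (cong (λ m → (bit b + m) % 2) (*-comm 2 n)) (trans ([m+kn]%n≡m%n (bit b) n 2) (bit%2 b))
  where
  bit%2 : ∀ b → bit b % 2 ≡ bit b
  bit%2 false = refl
  bit%2 true  = refl

bit+2*-injective : ∀ {a b m n} → bit a + 2 * m ≡ bit b + 2 * n → a ≡ b × m ≡ n
bit+2*-injective {a} {b} {m} {n} eq =
  a≡b , *-cancelˡ-≡ m n 2 (+-cancelˡ-≡ (bit a) _ _ (trans eq (cong (λ c → bit c + 2 * n) (sym a≡b))))
  where
  a≡b : a ≡ b
  a≡b = bit-injective (trans (sym ([bit+2*n]%2≡bit a m)) (trans (cong (_% 2) eq) ([bit+2*n]%2≡bit b n)))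

bin-++ : ∀ u w → bin (u ++ w) ≡ bin u + 2 ^ length u * bin w
bin-++ []      w = sym (+-identityʳ (bin w))
bin-++ (b ∷ u) w = trans (cong (λ x → bit b + 2 * x) (bin-++ u w)) (lemma (bit b) (bin u) (2 ^ length u) (bin w))
  where
  lemma : ∀ a x y z → a + 2 * (x + y * z) ≡ (a + 2 * x) + (2 * y) * z
  lemma = solve-∀

n<2^n : ∀ n → n < 2 ^ n
n<2^n zero    = s≤s z≤n
n<2^n (suc n) = begin-strict
  suc n         <⟨ s≤s (n<2^n n) ⟩
  suc (2 ^ n)   ≤⟨ +-monoˡ-≤ (2 ^ n) (m^n>0 2 n) ⟩
  2 ^ n + 2 ^ n ≡⟨ cong (2 ^ n +_) (+-identityʳ (2 ^ n)) ⟨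
  2 ^ suc n     ∎
  where open ≤-Reasoning

bits : ∀ k → ℕ → Fin k → Bool
bits (suc k) x Fin.zero    = x % 2 ≡ᵇ 1
bits (suc k) x (Fin.suc j) = bits k (x / 2) j

fromBits : ∀ {k} → (Fin k → Bool) → ℕ
fromBits v = bin (tabulate v)

n≡bit[n%2]+2*[n/2] : ∀ n → n ≡ bit (n % 2 ≡ᵇ 1) + 2 * (n / 2)
n≡bit[n%2]+2*[n/2] n with n % 2 | m%n<n n 2 | m≡m%n+[m/n]*n n 2
... | 0 | _ | n≡ = trans n≡ (cong (0 +_) (*-comm (n / 2) 2))
... | 1 | _ | n≡ = trans n≡ (cong (1 +_) (*-comm (n / 2) 2))
... | suc (suc _) | s≤s (s≤s ()) | _

fromBits-bits : ∀ k {n} → n < 2 ^ k → fromBits (bits k n) ≡ n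
fromBits-bits zero    n<1 = sym (n<1⇒n≡0 n<1)
fromBits-bits (suc k) {n} n<2^[1+k] = begin
  bit (n % 2 ≡ᵇ 1) + 2 * fromBits (bits k (n / 2)) ≡⟨ cong ((bit (n % 2 ≡ᵇ 1) +_) ∘ (2 *_)) (fromBits-bits k n/2<2^k) ⟩
  bit (n % 2 ≡ᵇ 1) + 2 * (n / 2)                   ≡⟨ n≡bit[n%2]+2*[n/2] n ⟨
  n                                                ∎
  where
  open ≡-Reasoning
  n/2<2^k : n / 2 < 2 ^ k
  n/2<2^k = m<n*o⇒m/o<n (subst (n <_) (*-comm 2 (2 ^ k)) n<2^[1+k])

fromBits< : ∀ {k} (v : Fin k → Bool) → fromBits v < 2 ^ k
fromBits< {zero}  v = s≤s z≤n
fromBits< {suc k} v = begin-strict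
  bit (v Fin.zero) + 2 * fromBits (v ∘ Fin.suc) <⟨ s≤s (+-monoˡ-≤ _ (bit≤1 (v Fin.zero))) ⟩
  2 + 2 * fromBits (v ∘ Fin.suc)                 ≡⟨ *-suc 2 (fromBits (v ∘ Fin.suc)) ⟨
  2 * suc (fromBits (v ∘ Fin.suc))               ≤⟨ *-monoʳ-≤ 2 (fromBits< (v ∘ Fin.suc)) ⟩
  2 * 2 ^ k                                      ∎
  where
  open ≤-Reasoning
  bit≤1 : ∀ b → bit b ≤ 1
  bit≤1 false = z≤n
  bit≤1 true  = ≤-refl

fromBits-injective : ∀ {k} (v w : Fin k → Bool) → fromBits v ≡ fromBits w → ∀ j → v j ≡ w j
fromBits-injective {suc k} v w eq j
  with bit+2*-injective {v Fin.zero} {w Fin.zero} {fromBits (v ∘ Fin.suc)} {fromBits (w ∘ Fin.suc)} eq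
fromBits-injective v w eq Fin.zero    | v0≡w0 , _ = v0≡w0
fromBits-injective v w eq (Fin.suc j) | _ , rest≡ = fromBits-injective (v ∘ Fin.suc) (w ∘ Fin.suc) rest≡ j

-- Counting subsets

¬¬-∀-Fin : ∀ {n} {P : Fin n → Set} → (∀ i → ¬ ¬ P i) → ¬ ¬ (∀ i → P i)
¬¬-∀-Fin {zero}  _   ¬∀P = ¬∀P (λ ())
¬¬-∀-Fin {suc n} ¬¬P ¬∀P = ¬¬P Fin.zero λ P0 → ¬¬-∀-Fin (¬¬P ∘ Fin.suc) λ P[1+] →
  ¬∀P λ { Fin.zero → P0 ; (Fin.suc i) → P[1+] i }

module _ {m n : ℕ} (P : (Fin m → Bool) → Fin n → Set)
         (reflects-⊆ : ∀ v w → (∀ j → P v j → P w j) → ∀ i → v i ≡ true → w i ≡ true) where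

  private
    subset : Fin (2 ^ m) → Fin m → Bool
    subset s = bits m (toℕ s)

    does-≡⇒ : ∀ {A B : Set} (a? : Dec A) (b? : Dec B) → does a? ≡ does b? → A → B
    does-≡⇒ (yes _)  (yes b) _  _ = b
    does-≡⇒ (yes _)  (no _)  () _
    does-≡⇒ (no ¬a)  _       _  a = contradiction a ¬a

    decided⇒≤ : (∀ s j → Dec (P (subset s) j)) → m ≤ n
    decided⇒≤ P? = m^n≤m^o⇒n≤o ≤-refl (injective⇒≤ code-injective)
      where
      outcomes : Fin (2 ^ m) → Fin n → Bool
      outcomes s j = does (P? s j)
      code : Fin (2 ^ m) → Fin (2 ^ n)
      code s = Fin.fromℕ< (fromBits< (outcomes s))
      code-injective : Injective _≡_ _≡_ code
      code-injective {s} {t} code≡ = toℕ-injective (begin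
        toℕ s                ≡⟨ fromBits-bits m (toℕ<n s) ⟨
        fromBits (subset s)  ≡⟨ cong bin (tabulate-cong subset-s≡t) ⟩
        fromBits (subset t)  ≡⟨ fromBits-bits m (toℕ<n t) ⟩
        toℕ t                ∎)
        where
        open ≡-Reasoning
        same-outcomes : ∀ j → outcomes s j ≡ outcomes t j
        same-outcomes = fromBits-injective (outcomes s) (outcomes t)
          (trans (sym (toℕ-fromℕ< (fromBits< (outcomes s))))
            (trans (cong toℕ code≡) (toℕ-fromℕ< (fromBits< (outcomes t)))))
        subset-s≡t : ∀ i → subset s i ≡ subset t i
        subset-s≡t i = ⇔→≡ (mk⇔
          (reflects-⊆ (subset s) (subset t) (λ j → does-≡⇒ (P? s j) (P? t j) (same-outcomes j)) i)
          (reflects-⊆ (subset t) (subset s) (λ j → does-≡⇒ (P? t j) (P? s j) (sym (same-outcomes j))) i))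

  -- Deciding the tests is only possible under ¬¬, which suffices since m ≤ n is decidable.
  reflecting-tests⇒≤ : m ≤ n
  reflecting-tests⇒≤ = decidable-stable (m ≤? n) λ m≰n →
    ¬¬-∀-Fin (λ s → ¬¬-∀-Fin (λ j → ¬¬-excluded-middle)) (m≰n ∘ decided⇒≤)

Eval-mono : ∀ {Q : Set} {V V′ : Q → Set} φ →
  (∀ {q} → Occurs q φ → V q → V′ q) → Eval V φ → Eval V′ φ
Eval-mono (atom q) V⇒V′ v        = V⇒V′ here v
Eval-mono tt       _     v        = v
Eval-mono ff       _     v        = v
Eval-mono (φ ∧ ψ)  V⇒V′ (v , w)  = Eval-mono φ (V⇒V′ ∘ ∧ˡ) v , Eval-mono ψ (V⇒V′ ∘ ∧ʳ) w
Eval-mono (φ ∨ ψ)  V⇒V′ (inj₁ v) = inj₁ (Eval-mono φ (V⇒V′ ∘ ∨ˡ) v)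
Eval-mono (φ ∨ ψ)  V⇒V′ (inj₂ w) = inj₂ (Eval-mono ψ (V⇒V′ ∘ ∨ʳ) w)

Wins-++-mono : ∀ {A} (M : AltMachine A) q u {w w′} →
  (∀ {q′} → Reach M q u q′ → Wins M q′ w → Wins M q′ w′) → Wins M q (u ++ w) → Wins M q (u ++ w′)
Wins-++-mono M q []      reach⇒ = reach⇒ start
Wins-++-mono M q (a ∷ u) reach⇒ =
  Eval-mono (AltMachine.δ M q a) (λ occurs → Wins-++-mono M _ u (reach⇒ ∘ step occurs))

-- Admissibility

∣-shift-difference : ∀ {p b k d a} → p ∣ b * k + a → p ∣ b * (k + d) + a → p ∣ b * d
∣-shift-difference {p} {b} {k} {d} {a} p∣b*k+a p∣b*[k+d]+a =
  ∣m+n∣m⇒∣n (subst (p ∣_) (lemma b k d a) p∣b*[k+d]+a) p∣b*k+a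
  where
  lemma : ∀ b k d a → b * (k + d) + a ≡ (b * k + a) + b * d
  lemma = solve-∀

-- Taking p = U j₀ from the shift k = 0 gives p > T; then two of the T + 1 shifts k = 0, …, T
-- are covered by the same U j, so p divides b (k′ − k) with 0 < k′ − k ≤ T.
prime-cannot-cover-shifts : ∀ {b T p} (U : Fin T → ℕ) → (∀ j → Prime (U j)) → (∀ j → T < U j) →
  (∀ {q} → Prime q → q ∣ b → q ≤ T) → Prime p → ¬ (∀ k → ∃[ j ] p ∣ b * k + U j)
prime-cannot-cover-shifts {b} {T} {p} U U-prime T<U b-factors p-prime covers
  with pigeonhole (n<1+n T) (proj₁ ∘ covers ∘ toℕ)
... | i , i′ , i<i′ , j≡j′ =
  [ (λ p∣b → <⇒≱ T<p (b-factors p-prime p∣b)) , (λ p∣d → <⇒≱ T<p (≤-trans (∣⇒≤ p∣d) d≤T)) ]′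
    (euclidsLemma b d p-prime p∣b*d)
  where
  T<p : T < p
  T<p with covers 0
  ... | j₀ , p∣b*0+U
    with prime⇒irreducible (U-prime j₀) (subst (λ x → p ∣ x + U j₀) (*-zeroʳ b) p∣b*0+U)
  ...   | inj₁ p≡1    = contradiction p≡1 (>⇒≢ (prime>1 p-prime))
  ...   | inj₂ p≡U[j₀] = subst (T <_) (sym p≡U[j₀]) (T<U j₀)
  d : ℕ
  d = toℕ i′ ∸ toℕ i
  instance
    d≢0 : NonZero d
    d≢0 = >-nonZero (m<n⇒0<n∸m i<i′)
  d≤T : d ≤ T
  d≤T = ≤-trans (m∸n≤m (toℕ i′) (toℕ i)) (≤-pred (toℕ<n i′))
  p∣b*d : p ∣ b * d
  p∣b*d = ∣-shift-difference {b = b} {toℕ i} {d} (proj₂ (covers (toℕ i)))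
    (subst₂ (λ j k → p ∣ b * k + U j) (sym j≡j′) (sym (m+[n∸m]≡n (<⇒≤ i<i′))) (proj₂ (covers (toℕ i′))))

module LowerBound (hyp : Hypothesis) (M : AltMachine Bool) (M-recognises : Recognises M Primes)
  {n : ℕ} (qs : List (AltMachine.Q M)) (qs-complete : ∀ w q → length w ≤ n → AppearsIn M w q → q ∈ qs)
  {T : ℕ} (2≤T : 2 ≤ T) (U : Fin T → ℕ) (U-injective : Injective _≡_ _≡_ U)
  (U-prime : ∀ j → Prime (U j)) (T<U : ∀ j → T < U j) (U<2^n : ∀ j → U j < 2 ^ n) where

  b : ℕ
  b = 2 ^ n

  member? : (v : Fin T → Bool) (i : Fin b) → Dec (∃[ j ] v j ≡ true × U j ≡ toℕ i)
  member? v i = any? (λ j → (v j ≟ᵇ true) ×-dec (U j ≟ toℕ i))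

  -- The set S ⊆ {1, …, b − 1} of the hypothesis: the residues U j with v j = true.
  S : (Fin T → Bool) → Fin b → Bool
  S v i = does (member? v i)

  S-true⇒ : ∀ {v i} → S v i ≡ true → ∃[ j ] v j ≡ true × U j ≡ toℕ i
  S-true⇒ {v} {i} with member? v i
  ... | yes found = λ _ → found
  ... | no  _     = λ ()

  S-zero : ∀ v i → toℕ i ≡ 0 → S v i ≡ false
  S-zero v i i≡0 = dec-false (member? v i) λ (j , _ , Uj≡i) →
    <⇒≢ (≤-trans (s≤s z≤n) (T<U j)) (sym (trans Uj≡i i≡0))

  index : Fin T → Fin b
  index j = Fin.fromℕ< (U<2^n j)

  S-index : ∀ v j → S v (index j) ≡ v j
  S-index v j = ⇔→≡ (mk⇔ member⇒ ⇒member)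
    where
    toℕ-index : toℕ (index j) ≡ U j
    toℕ-index = toℕ-fromℕ< (U<2^n j)
    member⇒ : S v (index j) ≡ true → v j ≡ true
    member⇒ S≡true with S-true⇒ S≡true
    ... | j′ , vj′≡true , Uj′≡ = subst (λ k → v k ≡ true) (U-injective (trans Uj′≡ toℕ-index)) vj′≡true
    ⇒member : v j ≡ true → S v (index j) ≡ true
    ⇒member vj≡true = dec-true (member? v (index j)) (j , vj≡true , sym toℕ-index)

  prime∣prodS⇒covers : ∀ {v p} → Prime p → ∀ k → p ∣ prodS b (S v) k → ∃[ j ] p ∣ b * k + U j
  prime∣prodS⇒covers {v} {p} p-prime k p∣prod
    with Any.satisfied (Any.map⁻ {xs = allFin b} (prime∣product⇒∣some p-prime _ p∣prod))
  ... | i , p∣term with S v i in S≡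
  ...   | false = contradiction p∣term (prime∤1 p-prime)
  ...   | true with S-true⇒ S≡
  ...     | j , _ , Uj≡i = j , subst (λ a → p ∣ b * k + a) (sym Uj≡i) p∣term

  S-admissible : ∀ v → ¬ (∃[ p ] Prime p × (∀ k → p ∣ prodS b (S v) k))
  S-admissible v (p , p-prime , p∣prod) =
    prime-cannot-cover-shifts U U-prime T<U b-factors p-prime (λ k → prime∣prodS⇒covers p-prime k (p∣prod k))
    where
    b-factors : ∀ {q} → Prime q → q ∣ b → q ≤ T
    b-factors q-prime q∣b = ≤-trans (∣⇒≤ (prime∣m^n⇒∣m n q-prime q∣b)) 2≤T

  prime-pattern : ∀ v → ∃[ k ] ∀ (i : Fin b) → 1 ≤ toℕ i → Prime (b * k + toℕ i) ⇔ S v i ≡ true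
  prime-pattern v = hyp b (m^n>0 2 n) (S v) (S-zero v) (S-admissible v)

  shift : (Fin T → Bool) → ℕ
  shift v = proj₁ (prime-pattern v)

  prime⇔ : ∀ v j → Prime (b * shift v + U j) ⇔ v j ≡ true
  prime⇔ v j = subst₂ (λ a c → Prime (b * shift v + a) ⇔ c ≡ true) (toℕ-fromℕ< (U<2^n j)) (S-index v j)
    (proj₂ (prime-pattern v) (index j)
      (subst (1 ≤_) (sym (toℕ-fromℕ< (U<2^n j))) (≤-trans (s≤s z≤n) (T<U j))))

  prefix : Fin T → List Bool
  prefix j = tabulate (bits n (U j))

  |prefix| : ∀ {j} → length (prefix j) ≡ n
  |prefix| {j} = length-tabulate (bits n (U j))

  suffix : (Fin T → Bool) → List Bool
  suffix v = tabulate (bits (shift v) (shift v))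

  bin-prefix++suffix : ∀ j v → bin (prefix j ++ suffix v) ≡ b * shift v + U j
  bin-prefix++suffix j v = begin
    bin (prefix j ++ suffix v)                              ≡⟨ bin-++ (prefix j) (suffix v) ⟩
    bin (prefix j) + 2 ^ length (prefix j) * bin (suffix v) ≡⟨ cong₂ (λ x m → x + 2 ^ m * bin (suffix v)) bin-prefix |prefix| ⟩
    U j + b * bin (suffix v)                                ≡⟨ cong (λ x → U j + b * x) bin-suffix ⟩
    U j + b * shift v                                       ≡⟨ +-comm (U j) (b * shift v) ⟩
    b * shift v + U j                                       ∎
    where
    open ≡-Reasoning
    bin-prefix : bin (prefix j) ≡ U j
    bin-prefix = fromBits-bits n (U<2^n j)
    bin-suffix : bin (suffix v) ≡ shift v
    bin-suffix = fromBits-bits (shift v) (n<2^n (shift v))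

  accepts⇔ : ∀ v j → Accepts M (prefix j ++ suffix v) ⇔ v j ≡ true
  accepts⇔ v j = prime⇔ v j ⇔-∘ subst (λ x → Accepts M (prefix j ++ suffix v) ⇔ Prime x)
    (bin-prefix++suffix j v) (M-recognises (prefix j ++ suffix v))

  -- Every state reached on a prefix is one of the qs, so the states of qs that win on the suffix
  -- determine which prefixes are accepted.
  suffix-reflects-⊆ : ∀ v w → (∀ i → Wins M (lookup qs i) (suffix v) → Wins M (lookup qs i) (suffix w)) →
    ∀ j → v j ≡ true → w j ≡ true
  suffix-reflects-⊆ v w wins⇒ j vj≡true = Equivalence.to (accepts⇔ w j)
    (Wins-++-mono M _ (prefix j) reach⇒ (Equivalence.from (accepts⇔ v j) vj≡true))
    where
    reach⇒ : ∀ {q} → Reach M (AltMachine.q₀ M) (prefix j) q → Wins M q (suffix v) → Wins M q (suffix w)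
    reach⇒ {q} reached with qs-complete (prefix j) q (≤-reflexive |prefix|) reached
    ... | q∈qs = subst (λ q → Wins M q (suffix v) → Wins M q (suffix w))
                   (sym (Any.lookup-index q∈qs)) (wins⇒ (Any.index q∈qs))

  T≤|qs| : T ≤ length qs
  T≤|qs| = reflecting-tests⇒≤ (λ v i → Wins M (lookup qs i) (suffix v)) suffix-reflects-⊆

*-distribʳ-^ : ∀ m n o → (m * n) ^ o ≡ m ^ o * n ^ o
*-distribʳ-^ m n zero    = refl
*-distribʳ-^ m n (suc o) = trans (cong (m * n *_) (*-distribʳ-^ m n o)) (lemma m n (m ^ o) (n ^ o))
  where
  lemma : ∀ m n x y → m * n * (x * y) ≡ m * x * (n * y)
  lemma = solve-∀

m^[n+n]≡[m*m]^n : ∀ m n → m ^ (n + n) ≡ (m * m) ^ n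
m^[n+n]≡[m*m]^n m n = trans (^-distribˡ-+-* m n n) (sym (*-distribʳ-^ m m n))

5^[r+r]<2^r*4^[r+r] : ∀ r .{{_ : NonZero r}} → 5 ^ (r + r) < 2 ^ r * 4 ^ (r + r)
5^[r+r]<2^r*4^[r+r] r = begin-strict
  5 ^ (r + r)         ≡⟨ m^[n+n]≡[m*m]^n 5 r ⟩
  25 ^ r              <⟨ ^-monoˡ-< r (from-yes (25 <? 32)) ⟩
  32 ^ r              ≡⟨ *-distribʳ-^ 2 16 r ⟩
  2 ^ r * 16 ^ r      ≡⟨ cong (2 ^ r *_) (m^[n+n]≡[m*m]^n 4 r) ⟨
  2 ^ r * 4 ^ (r + r) ∎
  where open ≤-Reasoning

8*[6+n]<2^[6+n] : ∀ n → 8 * (6 + n) < 2 ^ (6 + n)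
8*[6+n]<2^[6+n] zero    = from-yes (48 <? 64)
8*[6+n]<2^[6+n] (suc n) = begin-strict
  8 * (7 + n)                   ≡⟨ *-suc 8 (6 + n) ⟩
  8 + 8 * (6 + n)               <⟨ +-mono-< (<-trans 8<8*[6+n] IH) IH ⟩
  2 ^ (6 + n) + 2 ^ (6 + n)     ≡⟨ cong (2 ^ (6 + n) +_) (+-identityʳ (2 ^ (6 + n))) ⟨
  2 ^ (7 + n)                   ∎
  where
  open ≤-Reasoning
  8<8*[6+n] : 8 < 8 * (6 + n)
  8<8*[6+n] = <-≤-trans (from-yes (8 <? 48)) (*-monoʳ-≤ 8 (m≤m+n 6 n))
  IH : 8 * (6 + n) < 2 ^ (6 + n)
  IH = 8*[6+n]<2^[6+n] n

theorem9 : Hypothesis →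
    ¬ (Σ (ℕ → ℕ) λ f → Subexponential f × InAlt {Bool} f Primes)
theorem9 hyp (f , f-subexponential , M , M-recognises , C , appearing≤)
  with f-subexponential 5 4 (s≤s z≤n) ≤-refl C
... | N , eventually = <⇒≱ (5^[r+r]<2^r*4^[r+r] r) (begin
  2 ^ r * 4 ^ n       ≤⟨ *-monoˡ-≤ (4 ^ n) T≤[1+C]*f[n] ⟩
  suc C * f n * 4 ^ n ≤⟨ eventually n N≤n ⟩
  5 ^ n               ∎)
  where
  open ≤-Reasoning
  r n : ℕ
  r = 6 + N
  n = r + r
  N≤n : N ≤ n
  N≤n = ≤-trans (m≤n+m N 6) (m≤m+n r r)
  open ManyPrimes (5 + N) (8*[6+n]<2^[6+n] N) using (T; U; U-injective; U-prime; T<U; U<B)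
  T≤[1+C]*f[n] : T ≤ suc C * f n
  T≤[1+C]*f[n] with appearing≤ n
  ... | qs , |qs|≤C*f[n] , qs-complete = begin
    T           ≤⟨ LowerBound.T≤|qs| hyp M M-recognises qs qs-complete 2≤T U U-injective U-prime T<U U<B ⟩
    length qs   ≤⟨ |qs|≤C*f[n] ⟩
    C * f n     ≤⟨ *-monoˡ-≤ (f n) (n≤1+n C) ⟩
    suc C * f n ∎
    where
    2≤T : 2 ≤ T
    2≤T = ^-monoʳ-≤ 2 {1} {r} (s≤s z≤n)
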